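{- Let $c=(c_1,c_2)\in\mathbb N^2$ with $c_1,c_2\ge2$, and let $M$ be a proper $c$-multicomplex. If $Z$ is a chordless cycle in the Murai sphere $\mathrm{Bier}_c(M)$, then the length of $Z$ equals $4$.
   Context: A $c$-monomial is $x^a=x_1^{a_1}x_2^{a_2}$ with $0\le a_i\le c_i$. A $c$-multicomplex is a nonempty set $M$ of $c$-monomials closed under taking divisors; proper means not the set of all $c$-monomials. Let $\tilde X=\{x_i^{(j)}: i=1,2,\ 0\le j\le c_i\}$. For a $c$-monomial $x^a$, $i\in\{1,2\}$, $a_i<j\le c_i$, put $G(x^a;x_i^j)=\tilde X\setminus\{x_1^{(a_1)},x_2^{(a_2)},x_i^{(j)}\}$ and let $x^a\diamond x_i^j$ be obtained from $x^a$ by replacing $a_i$ by $j$. The Murai sphere $\mathrm{Bier}_c(M)$ is the simplicial complex on $\tilde X$ whose facets are the sets $G(x^a;x_i^j)$ with $x^a\in M$, $a_i<j\le c_i$, $x^a\diamond x_i^j\notin M$. A chordless cycle is a cycle of length at least $4$ in the 1-skeleton which is an induced subgraph. -}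

module Defs where

open import Data.Nat using (ℕ; suc; _∸_)
open import Data.Fin using (Fin; toℕ; _<_; _≤_)
open import Data.Bool using (Bool; true; false)
open import Data.Sum using (_⊎_; inj₁; inj₂)
open import Data.Product using (Σ; ∃; _×_; _,_)
open import Relation.Binary.PropositionalEquality using (_≡_; _≢_)

-- c = (c₁ , c₂).  A c-monomial x₁^a₁ x₂^a₂ with 0 ≤ aᵢ ≤ cᵢ is a pair
-- (a₁ , a₂) : Fin (suc c₁) × Fin (suc c₂).

MonSet : ℕ → ℕ → Set
MonSet c₁ c₂ = Fin (suc c₁) → Fin (suc c₂) → Bool

record IsMulticomplex {c₁ c₂ : ℕ} (M : MonSet c₁ c₂) : Set where
  field
    nonempty : Σ (Fin (suc c₁)) λ a₁ → Σ (Fin (suc c₂)) λ a₂ → M a₁ a₂ ≡ true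
    divClosed : ∀ a₁ a₂ b₁ b₂ → M a₁ a₂ ≡ true → b₁ ≤ a₁ → b₂ ≤ a₂ → M b₁ b₂ ≡ true

IsProper : {c₁ c₂ : ℕ} → MonSet c₁ c₂ → Set
IsProper {c₁} {c₂} M = Σ (Fin (suc c₁)) λ a₁ → Σ (Fin (suc c₂)) λ a₂ → M a₁ a₂ ≡ false

-- The vertex set X̃ = { x₁^(j) : 0 ≤ j ≤ c₁ } ∪ { x₂^(j) : 0 ≤ j ≤ c₂ };
-- inj₁ j is x₁^(j), inj₂ j is x₂^(j).
Vertex : ℕ → ℕ → Set
Vertex c₁ c₂ = Fin (suc c₁) ⊎ Fin (suc c₂)

-- Index data of a facet G(x^a ; xᵢ^j): the monomial (a₁ , a₂) and the
-- vertex xᵢ^(j), encoded as inj₁ j (i = 1) or inj₂ j (i = 2).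
-- Validity condition: x^a ∈ M, aᵢ < j ≤ cᵢ and x^a ⋄ xᵢ^j ∉ M.
ValidFacetIndex : {c₁ c₂ : ℕ} → MonSet c₁ c₂ →
                  Fin (suc c₁) → Fin (suc c₂) → Vertex c₁ c₂ → Set
ValidFacetIndex M a₁ a₂ (inj₁ j) = M a₁ a₂ ≡ true × a₁ < j × M j a₂ ≡ false
ValidFacetIndex M a₁ a₂ (inj₂ j) = M a₁ a₂ ≡ true × a₂ < j × M a₁ j ≡ false

InG : {c₁ c₂ : ℕ} → Fin (suc c₁) → Fin (suc c₂) → Vertex c₁ c₂ → Vertex c₁ c₂ → Set
InG a₁ a₂ w v = v ≢ inj₁ a₁ × v ≢ inj₂ a₂ × v ≢ w

-- Edges of the 1-skeleton of Bier_c(M): two distinct vertices lying in a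
-- common facet (equivalently, {u,v} is a face).
BierEdge : {c₁ c₂ : ℕ} → MonSet c₁ c₂ → Vertex c₁ c₂ → Vertex c₁ c₂ → Set
BierEdge {c₁} {c₂} M u v =
  u ≢ v ×
  Σ (Fin (suc c₁)) λ a₁ → Σ (Fin (suc c₂)) λ a₂ → Σ (Vertex c₁ c₂) λ w →
    ValidFacetIndex M a₁ a₂ w × InG a₁ a₂ w u × InG a₁ a₂ w v

CycNext : (n : ℕ) → Fin n → Fin n → Set
CycNext n k l = (toℕ l ≡ suc (toℕ k)) ⊎ (toℕ k ≡ n ∸ 1 × toℕ l ≡ 0)

record IsChordlessCycle {V : Set} (E : V → V → Set) (n : ℕ) (Z : Fin n → V) : Set where
  field
    atLeast4  : 4 Data.Nat.≤ n
    injective : ∀ k l → Z k ≡ Z l → k ≡ l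
    edges     : ∀ k l → CycNext n k l → E (Z k) (Z l)
    induced   : ∀ k l → E (Z k) (Z l) → CycNext n k l ⊎ CycNext n l k

{-# OPTIONS --safe #-}
-- A facet of Bier_c(M) misses exactly the three vertices x₁^(a₁), x₂^(a₂), xᵢ^(j). If a chordless
-- cycle had length at least 5, its first five vertices z₀, …, z₄ would have the non-edges {zₖ , zₖ₊₂},
-- so every facet misses a vertex of each such pair. These pairs form a 5-cycle, which needs three
-- vertices to cover it, so each facet misses only vertices among z₀, …, z₄. As M is a proper
-- multicomplex, every vertex is missed by some facet; then all c₁ + c₂ + 2 ≥ 6 vertices would lie
-- among five.
module Submission where

open import Defs
open import Data.Nat using (ℕ; _≤_)
open import Data.Fin using (Fin)
open import Relation.Binary.PropositionalEquality using (_≡_)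

open import Level using (Level)
open import Data.Nat as ℕ using (suc; _+_; z≤n; s≤s)
open import Data.Nat.Properties using (≤-antisym; ≮⇒≥; ≤⇒≯; 1+n≰n; +-mono-≤; m≤n⇒∃[o]m+o≡n)
open import Data.Fin using (zero; suc; fromℕ; _↑ˡ_; _≟_) renaming (_≤_ to _≤ᶠ_; _<_ to _<ᶠ_)
open import Data.Fin.Patterns using (0F; 1F; 2F; 3F; 4F)
open import Data.Fin.Properties using (all?; injective⇒≤; +↔⊎; ↑ˡ-injective; ≤fromℕ; ≤∧≢⇒<)
open import Data.Vec.Functional using (Vector; _∷_; [])
open import Data.Vec.Functional.Relation.Unary.Any using (Any; any)
open import Data.Bool using (Bool; true; false)
open import Data.Sum using (_⊎_; inj₁; inj₂; [_,_]′)
open import Data.Sum.Properties using (≡-dec)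
open import Data.Product using (Σ-syntax; _×_; _,_; proj₁; proj₂; uncurry)
open import Data.Empty using (⊥-elim)
open import Function using (_∘_; Injection)
open import Function.Definitions using (Injective)
open import Function.Properties.Inverse using (↔⇒↣)
open import Relation.Nullary using (¬_; yes; no; contradiction)
open import Relation.Nullary.Decidable using (Dec; True; map′; toWitness; _→-dec_)
open import Relation.Unary using (Pred)
open import Relation.Binary.Definitions using (DecidableEquality)
open import Relation.Binary.PropositionalEquality using (_≢_; refl; sym; trans; cong; module ≡-Reasoning)

private
  variable
    a p : Level
    A : Set a
    m n : ℕ
    x : A

_∈_ : A → Vector A n → Set _
x ∈ xs = Any (_≡ x) xs

_⊆_ : Vector A m → Vector A n → Set _
xs ⊆ ys = ∀ {x} → x ∈ xs → x ∈ ys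

⊆-∘ : {xs : Vector A n} (f : Fin m → Fin n) → (xs ∘ f) ⊆ xs
⊆-∘ f (i , eq) = f i , eq

injective-∷ : {xs : Vector A n} → ¬ x ∈ xs → Injective _≡_ _≡_ xs → Injective _≡_ _≡_ (x ∷ xs)
injective-∷ x∉xs xs-inj {zero}  {zero}  _  = refl
injective-∷ x∉xs xs-inj {zero}  {suc j} eq = contradiction (j , sym eq) x∉xs
injective-∷ x∉xs xs-inj {suc i} {zero}  eq = contradiction (i , eq) x∉xs
injective-∷ x∉xs xs-inj {suc i} {suc j} eq = cong suc (xs-inj eq)

injective-⊆⇒≤ : {xs : Vector A m} {ys : Vector A n} → Injective _≡_ _≡_ xs → xs ⊆ ys → m ≤ n
injective-⊆⇒≤ {xs = xs} {ys} xs-inj xs⊆ys = injective⇒≤ position-injective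
  where
  open ≡-Reasoning
  position : Fin _ → Fin _
  position i = proj₁ (xs⊆ys (i , refl))

  position-injective : Injective _≡_ _≡_ position
  position-injective {i} {j} eq = xs-inj (begin
    xs i                ≡⟨ sym (proj₂ (xs⊆ys (i , refl))) ⟩
    ys (position i)     ≡⟨ cong ys eq ⟩
    ys (position j)     ≡⟨ proj₂ (xs⊆ys (j , refl)) ⟩
    xs j                ∎)

module _ (_≟ᴬ_ : DecidableEquality A) where

  injective-⊆⇒⊇ : {xs ys : Vector A n} → Injective _≡_ _≡_ xs → xs ⊆ ys → ys ⊆ xs
  injective-⊆⇒⊇ {xs = xs} {ys} xs-inj xs⊆ys {y} y∈ys with any (_≟ᴬ y) xs
  ... | yes y∈xs = y∈xs
  ... | no  y∉xs = contradiction (injective-⊆⇒≤ (injective-∷ y∉xs xs-inj) y∷xs⊆ys) 1+n≰n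
    where
    y∷xs⊆ys : (y ∷ xs) ⊆ ys
    y∷xs⊆ys (zero  , refl) = y∈ys
    y∷xs⊆ys (suc i , eq)   = xs⊆ys (i , eq)

distinguished-by : (f : A → Bool) {x y : A} → f x ≡ true → f y ≡ false → x ≢ y
distinguished-by f fx fy refl = contradiction (trans (sym fx) fy) λ ()

injective? : (f : Fin m → Fin n) → Dec (Injective _≡_ _≡_ f)
injective? f = map′ (λ inj → inj _ _) (λ inj _ _ → inj)
                    (all? λ i → all? λ j → f i ≟ f j →-dec i ≟ j)

two-ahead : Fin 5 → Fin 5
two-ahead 0F = 2F
two-ahead 1F = 3F
two-ahead 2F = 4F
two-ahead 3F = 0F
two-ahead 4F = 1F

two-ahead-≢ : ∀ k → k ≢ two-ahead k
two-ahead-≢ 0F ()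
two-ahead-≢ 1F ()
two-ahead-≢ 2F ()
two-ahead-≢ 3F ()
two-ahead-≢ 4F ()

module _ {P : Pred (Fin 5) p} where

  private
    triple : ∀ {i j k} → P i → P j → P k → {True (injective? (i ∷ j ∷ k ∷ []))} →
             Σ[ h ∈ (Fin 3 → Fin 5) ] Injective _≡_ _≡_ h × (∀ i → P (h i))
    triple {i} {j} {k} pi pj pk {distinct} =
      i ∷ j ∷ k ∷ [] , toWitness distinct , λ { 0F → pi ; 1F → pj ; 2F → pk }

  -- The pairs {k , k + 2} form a 5-cycle, and a vertex cover of a 5-cycle has at least three vertices.
  pentagon-cover : (∀ k → P k ⊎ P (two-ahead k)) →
                   Σ[ h ∈ (Fin 3 → Fin 5) ] Injective _≡_ _≡_ h × (∀ i → P (h i))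
  pentagon-cover cover with cover 0F | cover 2F | cover 4F | cover 1F | cover 3F
  ... | inj₁ p0 | inj₁ p2 | inj₁ p4 | _       | _       = triple p0 p2 p4
  ... | inj₁ p0 | inj₁ p2 | inj₂ p1 | _       | _       = triple p0 p2 p1
  ... | inj₁ p0 | inj₂ p4 | _       | inj₁ p1 | _       = triple p0 p4 p1
  ... | inj₁ p0 | inj₂ p4 | _       | inj₂ p3 | _       = triple p0 p4 p3
  ... | inj₂ p2 | _       | inj₁ p4 | _       | inj₁ p3 = triple p2 p4 p3
  ... | inj₂ p2 | _       | inj₁ p4 | _       | inj₂ p0 = triple p2 p4 p0
  ... | inj₂ p2 | _       | inj₂ p1 | _       | inj₁ p3 = triple p2 p1 p3
  ... | inj₂ p2 | _       | inj₂ p1 | _       | inj₂ p0 = triple p2 p1 p0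

module _ {V : Set} {E : V → V → Set} {Z : Fin n → V} (cyc : IsChordlessCycle E n Z) where
  open IsChordlessCycle cyc

  non-consecutive⇒non-adjacent : ∀ {k l} → ¬ CycNext n k l → ¬ CycNext n l k → ¬ E (Z k) (Z l)
  non-consecutive⇒non-adjacent ¬kl ¬lk e = [ ¬kl , ¬lk ]′ (induced _ _ e)

module FirstFive {V : Set} {E : V → V → Set} {Z : Fin (5 + m) → V}
                 (cyc : IsChordlessCycle E (5 + m) Z) where
  open IsChordlessCycle cyc

  z : Vector V 5
  z k = Z (k ↑ˡ m)

  z-injective : Injective _≡_ _≡_ z
  z-injective {k} {l} eq = ↑ˡ-injective m k l (injective _ _ eq)

  two-ahead-non-consecutive : ∀ k → ¬ CycNext (5 + m) (k ↑ˡ m) (two-ahead k ↑ˡ m)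
                                  × ¬ CycNext (5 + m) (two-ahead k ↑ˡ m) (k ↑ˡ m)
  two-ahead-non-consecutive 0F = (λ { (inj₁ ()) ; (inj₂ (() , _)) }) , (λ { (inj₁ ()) ; (inj₂ (() , _)) })
  two-ahead-non-consecutive 1F = (λ { (inj₁ ()) ; (inj₂ (() , _)) }) , (λ { (inj₁ ()) ; (inj₂ (() , _)) })
  two-ahead-non-consecutive 2F = (λ { (inj₁ ()) ; (inj₂ (() , _)) }) , (λ { (inj₁ ()) ; (inj₂ (_ , ())) })
  two-ahead-non-consecutive 3F = (λ { (inj₁ ()) ; (inj₂ (() , _)) }) , (λ { (inj₁ ()) ; (inj₂ (() , _)) })
  two-ahead-non-consecutive 4F = (λ { (inj₁ ()) ; (inj₂ (_ , ())) }) , (λ { (inj₁ ()) ; (inj₂ (() , _)) })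

  z-two-ahead-non-adjacent : ∀ k → ¬ E (z k) (z (two-ahead k))
  z-two-ahead-non-adjacent k = uncurry (non-consecutive⇒non-adjacent cyc) (two-ahead-non-consecutive k)

  z-two-ahead-≢ : ∀ k → z k ≢ z (two-ahead k)
  z-two-ahead-≢ k = two-ahead-≢ k ∘ z-injective

module _ {c₁ c₂ : ℕ} (M : MonSet c₁ c₂) where

  _≟ᵛ_ : DecidableEquality (Vertex c₁ c₂)
  _≟ᵛ_ = ≡-dec _≟_ _≟_

  facetComplement : Fin (suc c₁) → Fin (suc c₂) → Vertex c₁ c₂ → Vector (Vertex c₁ c₂) 3
  facetComplement a₁ a₂ w = inj₁ a₁ ∷ inj₂ a₂ ∷ w ∷ []

  ∉facetComplement⇒InG : ∀ {a₁ a₂ w v} → ¬ v ∈ facetComplement a₁ a₂ w → InG a₁ a₂ w v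
  ∉facetComplement⇒InG v∉ = (λ eq → v∉ (0F , sym eq)) , (λ eq → v∉ (1F , sym eq)) , (λ eq → v∉ (2F , sym eq))

  non-edge-meets-facetComplement : ∀ {a₁ a₂ w u v} → ValidFacetIndex M a₁ a₂ w → u ≢ v → ¬ BierEdge M u v →
                                   u ∈ facetComplement a₁ a₂ w ⊎ v ∈ facetComplement a₁ a₂ w
  non-edge-meets-facetComplement {a₁} {a₂} {w} {u} {v} valid u≢v ¬uv
    with any (_≟ᵛ u) (facetComplement a₁ a₂ w) | any (_≟ᵛ v) (facetComplement a₁ a₂ w)
  ... | yes u∈ | _      = inj₁ u∈
  ... | no _   | yes v∈ = inj₂ v∈
  ... | no u∉  | no v∉  =
    ⊥-elim (¬uv (u≢v , a₁ , a₂ , w , valid , ∉facetComplement⇒InG u∉ , ∉facetComplement⇒InG v∉))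

  module _ {Z : Fin (5 + m) → Vertex c₁ c₂} (cyc : IsChordlessCycle (BierEdge M) (5 + m) Z) where
    open FirstFive cyc

    facetComplement⊆first-five : ∀ {a₁ a₂ w} → ValidFacetIndex M a₁ a₂ w → facetComplement a₁ a₂ w ⊆ z
    facetComplement⊆first-five valid
      with pentagon-cover (λ k → non-edge-meets-facetComplement valid (z-two-ahead-≢ k) (z-two-ahead-non-adjacent k))
    ... | h , h-injective , z∘h∈ =
      ⊆-∘ h ∘ injective-⊆⇒⊇ _≟ᵛ_ (h-injective ∘ z-injective) λ { (i , refl) → z∘h∈ i }

  MissedByFacet : Vertex c₁ c₂ → Set
  MissedByFacet v = Σ[ a₁ ∈ Fin (suc c₁) ] Σ[ a₂ ∈ Fin (suc c₂) ] Σ[ w ∈ Vertex c₁ c₂ ]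
                      ValidFacetIndex M a₁ a₂ w × v ∈ facetComplement a₁ a₂ w

  ∈∧∉∧≤⇒<₁ : ∀ {a₁ b₁ a₂} → M a₁ a₂ ≡ true → M b₁ a₂ ≡ false → a₁ ≤ᶠ b₁ → a₁ <ᶠ b₁
  ∈∧∉∧≤⇒<₁ {a₂ = a₂} a∈M b∉M a≤b = ≤∧≢⇒< a≤b (distinguished-by (λ x → M x a₂) a∈M b∉M)

  ∈∧∉∧≤⇒<₂ : ∀ {a₁ a₂ b₂} → M a₁ a₂ ≡ true → M a₁ b₂ ≡ false → a₂ ≤ᶠ b₂ → a₂ <ᶠ b₂
  ∈∧∉∧≤⇒<₂ {a₁ = a₁} a∈M b∉M a≤b = ≤∧≢⇒< a≤b (distinguished-by (M a₁) a∈M b∉M)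

  module _ (mc : IsMulticomplex M) (proper : IsProper M) where
    open IsMulticomplex mc

    origin∈M : M 0F 0F ≡ true
    origin∈M with nonempty
    ... | a₁ , a₂ , a∈M = divClosed a₁ a₂ 0F 0F a∈M z≤n z≤n

    top₁ : Fin (suc c₁)
    top₁ = fromℕ c₁

    top₂ : Fin (suc c₂)
    top₂ = fromℕ c₂

    top∉M : M top₁ top₂ ≡ false
    top∉M with M top₁ top₂ in top∈M
    ... | false = refl
    ... | true  = contradiction (trans (sym (divClosed _ _ _ _ top∈M (≤fromℕ _) (≤fromℕ _)))
                                       (proj₂ (proj₂ proper)))
                                λ ()

    -- The facet missing x₁^(j) depends on whether none, part or all of the row {(j , b)} lies in M.
    x₁-missed : ∀ j → MissedByFacet (inj₁ j)
    x₁-missed j with M j 0F in Mj0 | M j top₂ in Mjt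
    ... | false | _     = 0F , 0F , inj₁ j , (origin∈M , ∈∧∉∧≤⇒<₁ origin∈M Mj0 z≤n , Mj0) , 2F , refl
    ... | true  | false = j , 0F , inj₂ top₂ , (Mj0 , ∈∧∉∧≤⇒<₂ Mj0 Mjt z≤n , Mjt) , 0F , refl
    ... | true  | true  = j , top₂ , inj₁ top₁ , (Mjt , ∈∧∉∧≤⇒<₁ Mjt top∉M (≤fromℕ j) , top∉M) , 0F , refl

    x₂-missed : ∀ j → MissedByFacet (inj₂ j)
    x₂-missed j with M 0F j in M0j | M top₁ j in Mtj
    ... | false | _     = 0F , 0F , inj₂ j , (origin∈M , ∈∧∉∧≤⇒<₂ origin∈M M0j z≤n , M0j) , 2F , refl
    ... | true  | false = 0F , j , inj₁ top₁ , (M0j , ∈∧∉∧≤⇒<₁ M0j Mtj z≤n , Mtj) , 1F , refl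
    ... | true  | true  = top₁ , j , inj₂ top₂ , (Mtj , ∈∧∉∧≤⇒<₂ Mtj top∉M (≤fromℕ j) , top∉M) , 1F , refl

    every-vertex-missed : ∀ v → MissedByFacet v
    every-vertex-missed (inj₁ j) = x₁-missed j
    every-vertex-missed (inj₂ j) = x₂-missed j

    vertex∈first-five : {Z : Fin (5 + m) → Vertex c₁ c₂} (cyc : IsChordlessCycle (BierEdge M) (5 + m) Z) →
                        ∀ v → v ∈ FirstFive.z cyc
    vertex∈first-five cyc v with every-vertex-missed v
    ... | _ , _ , _ , valid , v∈ = facetComplement⊆first-five cyc valid v∈

    no-long-chordless-cycle : 2 ≤ c₁ → 2 ≤ c₂ → {Z : Fin n → Vertex c₁ c₂} → 4 ℕ.< n →
                              ¬ IsChordlessCycle (BierEdge M) n Z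
    no-long-chordless-cycle 2≤c₁ 2≤c₂ 4<n cyc with m≤n⇒∃[o]m+o≡n 4<n
    ... | _ , refl = ≤⇒≯ (injective-⊆⇒≤ (Injection.injective (↔⇒↣ +↔⊎)) λ {v} _ → vertex∈first-five cyc v)
                         (+-mono-≤ (s≤s 2≤c₁) (s≤s 2≤c₂))

mainTheorem6 : (c₁ c₂ : ℕ) → 2 ≤ c₁ → 2 ≤ c₂ →
               (M : MonSet c₁ c₂) → IsMulticomplex M → IsProper M →
               (n : ℕ) (Z : Fin n → Vertex c₁ c₂) →
               IsChordlessCycle (BierEdge M) n Z → n ≡ 4
mainTheorem6 c₁ c₂ 2≤c₁ 2≤c₂ M mc proper n Z cyc =
  ≤-antisym (≮⇒≥ λ 4<n → no-long-chordless-cycle M mc proper 2≤c₁ 2≤c₂ 4<n cyc)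
            (IsChordlessCycle.atLeast4 cyc)
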